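{- Let $G=(V,E)$ be a finite simple graph, let $\{b_1,\dots,b_k\}$ be a maximal matching of $G$ with $b_j=x_jy_j$, and define for $0\le j\le k$: $V_j:=V\setminus\bigcup_{j'>j} b_{j'}$, $E_j:=\{e\in E\mid e\subseteq V_j\}$, and $B_j:=E_j\setminus E_{j-1}$ for $j\ge 1$. Fix a linear ordering $e_1<e_2<\dots<e_m$ of $E$ such that (1) for every $j\ge1$, every $e\in E_{j-1}$ and every $f\in B_j$ we have $e<f$ (so each $E_j$ is an initial segment $\{e_1,\dots,e_{|E_j|}\}$), and (2) for every $j$, every $e\in B_j\setminus\{b_j\}$ incident to $x_j$ and every $f\in B_j\setminus\{b_j\}$ incident to $y_j$ (and not to $x_j$) we have $b_j<e<f$. Let $1\le i<k$. Then every $T\in tr(E_{i-1})$ has at least one descendant in $tr(E_i)$, i.e., there exists $T'\in tr(E_i)$ with $Q'\big(Q'(\cdots Q'(T',|E_i|),|E_i|-1)\cdots),|E_{i-1}|+1\big)=T$.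
   Context: For an edge $e=xy$, $N[e]$ denotes the set of edges sharing an endpoint with $e$ (including $e$). For $1\le j\le m$ let $\mathcal{F}_j:=\{N[e_1],\dots,N[e_j]\}$, a family of subsets of $E$, and $\mathcal{F}_0=\emptyset$. A set $T\subseteq E$ is a transversal of $\mathcal{F}_j$ if it intersects every member of $\mathcal{F}_j$; $tr(\mathcal{F}_j)$ is the set of inclusion-minimal transversals (so $tr(\mathcal{F}_0)=\{\emptyset\}$). For an edge set $E'=\{e_1,\dots,e_j\}$ (an initial segment) we write $tr(E')=tr(\mathcal{F}_j)$; these are the minimal sets $T\subseteq E$ such that every edge of $E'$ shares an endpoint with (or equals) some edge of $T$. For $T\subseteq E$ and $v\in T$, $P_{\mathcal{F}_j}(v,T):=\{F\in\mathcal{F}_j\mid F\cap T=\{v\}\}$. For $j\ge1$ and $T\in tr(\mathcal{F}_j)$, the parent $Q'(T,j)$ is $T$ if $T\in tr(\mathcal{F}_{j-1})$, and otherwise $T\setminus\{v\}$ for the unique $v\in T$ with $P_{\mathcal{F}_j}(v,T)=\{N[e_j]\}$; then $Q'(T,j)\in tr(\mathcal{F}_{j-1})$. -}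

module Defs where

open import Data.Nat using (ℕ; zero; suc; _+_; _∸_; _<_; _≤_; _<?_)
open import Data.Fin using (Fin; toℕ; fromℕ<; _≟_)
open import Data.Fin.Properties using (all?)
open import Data.Fin.Subset using (Subset; _∈_; _∉_; _⊂_; _-_; ∣_∣)
open import Data.Vec using (tabulate)
open import Data.Product using (Σ; ∃; _×_; _,_; proj₁; proj₂)
open import Data.Sum using (_⊎_; inj₁; inj₂)
open import Data.Empty using (⊥)
open import Relation.Nullary using (¬_; Dec; yes; no; does)
open import Relation.Nullary.Decidable using (_⊎-dec_; ¬?; _→-dec_)
open import Relation.Binary.PropositionalEquality using (_≡_; _≢_)
open import Function.Bundles using (_⇔_)

-- The index order on Fin m is
-- the fixed linear ordering e₁ < e₂ < … < e_m  (e_j is the edge with toℕ = j-1).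

SameEnds : ∀ {n} → Fin n × Fin n → Fin n × Fin n → Set
SameEnds (x , y) (x' , y') = (x ≡ x' × y ≡ y') ⊎ (x ≡ y' × y ≡ x')

record Graph : Set where
  field
    n m        : ℕ
    ends       : Fin m → Fin n × Fin n
    loopless   : ∀ e → proj₁ (ends e) ≢ proj₂ (ends e)
    noParallel : ∀ e f → SameEnds (ends e) (ends f) → e ≡ f

open Graph public

Incident : (G : Graph) → Fin (n G) → Fin (m G) → Set
Incident G v e = v ≡ proj₁ (ends G e) ⊎ v ≡ proj₂ (ends G e)

incident? : (G : Graph) → ∀ v e → Dec (Incident G v e)
incident? G v e = (v ≟ proj₁ (ends G e)) ⊎-dec (v ≟ proj₂ (ends G e))

-- f ∈ N[e] : f shares an endpoint with e (this includes f = e)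
InN : (G : Graph) → Fin (m G) → Fin (m G) → Set
InN G e f = Σ (Fin (n G)) λ v → Incident G v e × Incident G v f

-- Transversals of F_j = {N[e₁],…,N[e_j]}

IsTransversal : (G : Graph) → ℕ → Subset (m G) → Set
IsTransversal G j T = ∀ (i : Fin (m G)) → toℕ i < j → Σ (Fin (m G)) λ t → t ∈ T × InN G i t

MinTr : (G : Graph) → ℕ → Subset (m G) → Set
MinTr G j T = IsTransversal G j T × (∀ S → S ⊂ T → ¬ IsTransversal G j S)

Hits : (G : Graph) → Fin (m G) → Subset (m G) → Fin (m G) → Set
Hits G i T v = v ∈ T × InN G i v × (∀ t → t ∈ T → InN G i t → t ≡ v)

SameN : (G : Graph) → Fin (m G) → Fin (m G) → Set
SameN G i i' = ∀ f → InN G i f ⇔ InN G i' f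

-- P_{F_j}(v,T) = {N[e_j]}, where e_j is the edge with index i (j = toℕ i + 1)
PrivateOnly : (G : Graph) → Fin (m G) → Fin (m G) → Subset (m G) → Set
PrivateOnly G i v T =
  Hits G i T v × (∀ i' → toℕ i' ≤ toℕ i → Hits G i' T v → SameN G i' i)

-- S = Q'(T, j) with j = toℕ i + 1 (only for T ∈ tr(F_j))
ParentAt : (G : Graph) → Fin (m G) → Subset (m G) → Subset (m G) → Set
ParentAt G i T S =
  MinTr G (suc (toℕ i)) T ×
  ((MinTr G (toℕ i) T × S ≡ T) ⊎
   (¬ MinTr G (toℕ i) T × Σ (Fin (m G)) λ v → v ∈ T × PrivateOnly G i v T × S ≡ T - v))

Parent : (G : Graph) → ℕ → Subset (m G) → Subset (m G) → Set
Parent G zero    T S = ⊥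
Parent G (suc j) T S = Σ (j < m G) λ p → ParentAt G (fromℕ< p) T S

-- Descends G lo d T' T  :  Q'(Q'(⋯Q'(T', lo+d), lo+d-1)⋯, lo+1) = T
Descends : (G : Graph) → ℕ → ℕ → Subset (m G) → Subset (m G) → Set
Descends G lo zero    T' T = T' ≡ T
Descends G lo (suc d) T' T =
  Σ (Subset (m G)) λ S → Parent G (lo + suc d) T' S × Descends G lo d S T

-- Matchings: b : Fin k → Fin m lists b₁,…,b_k (b_j = b at index j-1).

IsMatching : (G : Graph) (k : ℕ) → (Fin k → Fin (m G)) → Set
IsMatching G k b = ∀ j j' → j ≢ j' → ∀ v → Incident G v (b j) → ¬ Incident G v (b j')

IsMaximalMatching : (G : Graph) (k : ℕ) → (Fin k → Fin (m G)) → Set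
IsMaximalMatching G k b =
  IsMatching G k b ×
  (∀ e → Σ (Fin k) λ j → Σ (Fin (n G)) λ v → Incident G v e × Incident G v (b j))

-- v ∈ V_j = V ∖ ⋃_{j' > j} b_{j'}   (matching index j'' : Fin k is b_{toℕ j'' + 1})
InV : (G : Graph) (k : ℕ) → (Fin k → Fin (m G)) → ℕ → Fin (n G) → Set
InV G k b j v = ∀ (j' : Fin k) → j < suc (toℕ j') → ¬ Incident G v (b j')

inV? : (G : Graph) (k : ℕ) (b : Fin k → Fin (m G)) → ∀ j v → Dec (InV G k b j v)
inV? G k b j v = all? λ j' → (j <? suc (toℕ j')) →-dec ¬? (incident? G v (b j'))

Ej : (G : Graph) (k : ℕ) → (Fin k → Fin (m G)) → ℕ → Subset (m G)
Ej G k b j = tabulate λ e →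
  does (inV? G k b j (proj₁ (ends G e))) Data.Bool.∧ does (inV? G k b j (proj₂ (ends G e)))
  where import Data.Bool

-- e ∈ B_j = E_j ∖ E_{j-1}, for the matching index j'' : Fin k (j = toℕ j'' + 1)
InB : (G : Graph) (k : ℕ) (b : Fin k → Fin (m G)) → Fin k → Fin (m G) → Set
InB G k b j e = e ∈ Ej G k b (suc (toℕ j)) × e ∉ Ej G k b (toℕ j)

OrderCond1 : (G : Graph) (k : ℕ) (b : Fin k → Fin (m G)) → Set
OrderCond1 G k b = ∀ (j : Fin k) e f →
  e ∈ Ej G k b (toℕ j) → InB G k b j f → toℕ e < toℕ f

OrderCond2 : (G : Graph) (k : ℕ) (b : Fin k → Fin (m G)) (x y : Fin k → Fin (n G)) → Set
OrderCond2 G k b x y =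
  (∀ (j : Fin k) e → InB G k b j e → e ≢ b j → Incident G (x j) e → toℕ (b j) < toℕ e) ×
  (∀ (j : Fin k) f → InB G k b j f → f ≢ b j → Incident G (y j) f → ¬ Incident G (x j) f →
     toℕ (b j) < toℕ f) ×
  (∀ (j : Fin k) e f → InB G k b j e → e ≢ b j → Incident G (x j) e →
     InB G k b j f → f ≢ b j → Incident G (y j) f → ¬ Incident G (x j) f →
     toℕ e < toℕ f)

-- Let b be the i-th matching edge. Every edge of E_{i-1} avoids b, every edge of B_i = E_i ∖ E_{i-1}
-- meets b, and by ordering condition (1) these are exactly the edges with indices below |E_{i-1}|,
-- resp. from |E_{i-1}| to |E_i| - 1. Walking up through B_i, T stays a minimal transversal (and is
-- its own parent) as long as it covers each new edge. At the first edge it misses, T ∪ {b} becomes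
-- minimal with b private to exactly that edge, so its parent is T; from then on T ∪ {b} covers every
-- further edge of B_i through b and is its own parent.
module Submission where

open import Defs
open import Data.Nat using (ℕ; zero; suc; _+_; _<_; _≤_; _∸_; z≤n; s≤s; s≤s⁻¹)
open import Data.Nat.Properties
  using (≤-trans; <-≤-trans; ≤-<-trans; ≤-reflexive; ≤-refl; <⇒≤; n≤1+n; m≤m+n; +-suc; +-identityʳ;
         m+[n∸m]≡n; m≤n⇒m<n∨m≡n; ≤∧≢⇒<; n≮0; <⇒≱; _<?_; ≮⇒≥; m≤n⇒m≤1+n)
import Data.Nat.Properties as ℕ
open import Data.Fin using (Fin; zero; suc; toℕ; fromℕ<)
open import Data.Fin.Properties using (any?; toℕ-fromℕ<; toℕ-injective; toℕ<n)
open import Data.Fin.Subset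
  using (Subset; inside; outside; _∈_; _∉_; _⊆_; _⊂_; _∪_; _─_; _-_; ⁅_⁆; ∣_∣; Empty)
open import Data.Fin.Subset.Properties
  using (_∈?_; x∈p∪q⁺; x∈p∪q⁻; x∈⁅x⁆; x∈⁅y⁆⇒x≡y; ⊆-antisym; p─q⊆p; x∈p∧x≢y⇒x∈p-y;
         Empty-unique; ∣⊥∣≡0; p⊆q⇒∣p∣≤∣q∣; ∣p∣≤n)
open import Data.Vec using (_∷_; here; there; tabulate)
open import Data.Vec.Properties using (lookup∘tabulate; []=⇒lookup; lookup⇒[]=)
open import Data.Bool using (Bool; T; _∧_)
open import Data.Bool.Properties using (T-≡)
open import Data.Product using (Σ; _×_; _,_; proj₁; proj₂)
open import Data.Unit using (tt)
open import Data.Sum using (_⊎_; inj₁; inj₂)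
open import Data.Empty using (⊥-elim)
open import Relation.Nullary using (¬_; Dec; yes; no; does)
open import Relation.Nullary.Decidable using (_×-dec_)
open import Relation.Binary.PropositionalEquality using (_≡_; refl; sym; trans; cong; subst)
open import Function.Bundles using (_⇔_; mk⇔; Equivalence)
open import Function.Construct.Identity using (⇔-id)
open import Function.Construct.Composition using (_⇔-∘_)

IsInitial : ∀ {n} → Subset n → Set
IsInitial p = ∀ e f → e ∈ p → f ∉ p → toℕ e < toℕ f

initial-∈⇔<∣∣ : ∀ {n} {p : Subset n} → IsInitial p → ∀ e → e ∈ p ⇔ toℕ e < ∣ p ∣
initial-∈⇔<∣∣ {p = inside ∷ p} initial zero = mk⇔ (λ _ → s≤s z≤n) (λ _ → here)
initial-∈⇔<∣∣ {p = inside ∷ p} initial (suc e) =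
  mk⇔ (λ { (there e∈p) → s≤s (to e∈p) }) (λ { (s≤s e<∣p∣) → there (from e<∣p∣) })
  where
  tail-initial : IsInitial p
  tail-initial e f e∈p f∉p = s≤s⁻¹ (initial (suc e) (suc f) (there e∈p) λ { (there f∈p) → f∉p f∈p })
  open Equivalence (initial-∈⇔<∣∣ tail-initial e)
initial-∈⇔<∣∣ {suc n} {outside ∷ p} initial e =
  mk⇔ (λ e∈p → ⊥-elim (empty (e , e∈p))) (λ e<∣p∣ → ⊥-elim (n≮0 (subst (toℕ e <_) size≡0 e<∣p∣)))
  where
  empty : Empty (outside ∷ p)
  empty (e , e∈p) = n≮0 (initial e zero e∈p λ ())
  size≡0 : ∣ outside ∷ p ∣ ≡ 0
  size≡0 = trans (cong ∣_∣ (Empty-unique empty)) (∣⊥∣≡0 (suc n))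

x∈p─q⇒x∉q : ∀ {n} {x : Fin n} (p q : Subset n) → x ∈ p ─ q → x ∉ q
x∈p─q⇒x∉q (inside ∷ p) (outside ∷ q) here ()
x∈p─q⇒x∉q (_ ∷ p) (outside ∷ q) (there x∈) (there x∈q) = x∈p─q⇒x∉q p q x∈ x∈q
x∈p─q⇒x∉q (_ ∷ p) (inside ∷ q) (there x∈) (there x∈q) = x∈p─q⇒x∉q p q x∈ x∈q

x∈p∪⁅y⁆⁻ : ∀ {n} {x y : Fin n} (p : Subset n) → x ∈ p ∪ ⁅ y ⁆ → x ∈ p ⊎ x ≡ y
x∈p∪⁅y⁆⁻ {y = y} p x∈ with x∈p∪q⁻ p ⁅ y ⁆ x∈
... | inj₁ x∈p = inj₁ x∈p
... | inj₂ x∈y = inj₂ (x∈⁅y⁆⇒x≡y y x∈y)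

p⊆q∪⁅x⁆⇒p-x⊆q : ∀ {n} {p q : Subset n} {x} → p ⊆ q ∪ ⁅ x ⁆ → p - x ⊆ q
p⊆q∪⁅x⁆⇒p-x⊆q {p = p} {q} {x} p⊆ y∈ with x∈p∪⁅y⁆⁻ q (p⊆ (p─q⊆p p ⁅ x ⁆ y∈))
... | inj₁ y∈q = y∈q
... | inj₂ refl = ⊥-elim (x∈p─q⇒x∉q p ⁅ x ⁆ y∈ (x∈⁅x⁆ x))

∈tabulate⇔ : ∀ {n} (f : Fin n → Bool) {i} → i ∈ tabulate f ⇔ T (f i)
∈tabulate⇔ f {i} = mk⇔
  (λ i∈ → Equivalence.from T-≡ (trans (sym (lookup∘tabulate f i)) ([]=⇒lookup i∈)))
  (λ fi → lookup⇒[]= i (tabulate f) (trans (lookup∘tabulate f i) (Equivalence.to T-≡ fi)))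

T-does-∧⇔ : ∀ {A B : Set} (A? : Dec A) (B? : Dec B) → T (does A? ∧ does B?) ⇔ (A × B)
T-does-∧⇔ (yes a) (yes b) = mk⇔ (λ _ → a , b) (λ _ → tt)
T-does-∧⇔ (yes _) (no ¬b) = mk⇔ (λ ()) (λ (_ , b) → ¬b b)
T-does-∧⇔ (no ¬a) _       = mk⇔ (λ ()) (λ (a , _) → ¬a a)

Covers : (G : Graph) → Subset (m G) → Fin (m G) → Set
Covers G S e = Σ (Fin (m G)) λ t → t ∈ S × InN G e t

covers? : (G : Graph) → ∀ S e → Dec (Covers G S e)
covers? G S e = any? λ t → (t ∈? S) ×-dec any? λ v → incident? G v e ×-dec incident? G v t

module Transversals (G : Graph) where

  IsTransversal-≤ : ∀ {j j' S} → j ≤ j' → IsTransversal G j' S → IsTransversal G j S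
  IsTransversal-≤ j≤j' tr i i<j = tr i (<-≤-trans i<j j≤j')

  IsTransversal-suc : ∀ {ι S} → IsTransversal G (toℕ ι) S → Covers G S ι →
                      IsTransversal G (suc (toℕ ι)) S
  IsTransversal-suc tr covers i i≤ι with m≤n⇒m<n∨m≡n (s≤s⁻¹ i≤ι)
  ... | inj₁ i<ι = tr i i<ι
  ... | inj₂ i≡ι = subst (Covers G _) (sym (toℕ-injective i≡ι)) covers

  MinTr-raise : ∀ {lo j T} → MinTr G lo T → lo ≤ j → IsTransversal G j T → MinTr G j T
  MinTr-raise (_ , minimal) lo≤j tr = tr , λ S S⊂T S-tr → minimal S S⊂T (IsTransversal-≤ lo≤j S-tr)

  ParentAt-self : ∀ {ι S} → MinTr G (toℕ ι) S → MinTr G (suc (toℕ ι)) S → ParentAt G ι S S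
  ParentAt-self min min' = min' , inj₁ (min , refl)

descend : (G : Graph) {lo hi : ℕ} (P : ℕ → Subset (m G) → Set) → lo ≤ hi → hi ≤ m G →
          (∀ ι {S} → lo ≤ toℕ ι → toℕ ι < hi → P (toℕ ι) S →
             Σ (Subset (m G)) λ S' → ParentAt G ι S' S × P (suc (toℕ ι)) S') →
          ∀ {T} → P lo T → Σ (Subset (m G)) λ T' → Descends G lo (hi ∸ lo) T' T × P hi T'
descend G {lo} {hi} P lo≤hi hi≤m step {T} pT =
  let T' , T'-descends , pT' = descend-by (hi ∸ lo) (≤-reflexive lo+[hi∸lo]≡hi) in
  T' , T'-descends , subst (λ j → P j T') lo+[hi∸lo]≡hi pT'
  where
  lo+[hi∸lo]≡hi : lo + (hi ∸ lo) ≡ hi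
  lo+[hi∸lo]≡hi = m+[n∸m]≡n lo≤hi

  descend-by : ∀ d → lo + d ≤ hi → Σ (Subset (m G)) λ T' → Descends G lo d T' T × P (lo + d) T'
  descend-by zero _ = T , refl , subst (λ j → P j T) (sym (+-identityʳ lo)) pT
  descend-by (suc d) lo+d+1≤hi = extend (descend-by d (<⇒≤ lo+d<hi))
    where
    lo+d<hi : lo + d < hi
    lo+d<hi = subst (_≤ hi) (+-suc lo d) lo+d+1≤hi
    p : lo + d < m G
    p = <-≤-trans lo+d<hi hi≤m
    ι≡lo+d : toℕ (fromℕ< p) ≡ lo + d
    ι≡lo+d = toℕ-fromℕ< p

    extend : (Σ (Subset (m G)) λ S → Descends G lo d S T × P (lo + d) S) →
             Σ (Subset (m G)) λ T' → Descends G lo (suc d) T' T × P (lo + suc d) T'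
    extend (S , S-descends , pS) =
      let S' , S'-parent , pS' = step (fromℕ< p) (subst (lo ≤_) (sym ι≡lo+d) (m≤m+n lo d))
                                      (subst (_< hi) (sym ι≡lo+d) lo+d<hi)
                                      (subst (λ j → P j S) (sym ι≡lo+d) pS)
      in S' , (S , subst (λ j → Parent G j S' S) (sym (+-suc lo d)) (p , S'-parent) , S-descends)
            , subst (λ j → P j S') (trans (cong suc ι≡lo+d) (sym (+-suc lo d))) pS'

module Extension (G : Graph) (b : Fin (m G)) {lo hi : ℕ}
                 (avoids : ∀ e → toℕ e < lo → ¬ InN G e b)
                 (meets : ∀ e → lo ≤ toℕ e → toℕ e < hi → InN G e b)
                 (T : Subset (m G)) (T-min : MinTr G lo T) where

  open Transversals G

  T⁺ : Subset (m G)
  T⁺ = T ∪ ⁅ b ⁆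

  T⊆T⁺ : T ⊆ T⁺
  T⊆T⁺ t∈T = x∈p∪q⁺ (inj₁ t∈T)

  b∈T⁺ : b ∈ T⁺
  b∈T⁺ = x∈p∪q⁺ (inj₂ (x∈⁅x⁆ b))

  Missed : ℕ → Set
  Missed j = Σ (Fin (m G)) λ e → toℕ e < j × ¬ Covers G T e

  Missed-suc : ∀ {j} → Missed j → Missed (suc j)
  Missed-suc (e , e<j , uncovered) = e , ≤-trans e<j (n≤1+n _) , uncovered

  b∉T : ∀ {e} → lo ≤ toℕ e → toℕ e < hi → ¬ Covers G T e → b ∉ T
  b∉T lo≤e e<hi uncovered b∈T = uncovered (b , b∈T , meets _ lo≤e e<hi)

  T⁺-transversal : ∀ {j} → j ≤ hi → IsTransversal G j T⁺
  T⁺-transversal j≤hi i i<j with toℕ i <? lo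
  ... | yes i<lo = let t , t∈T , i~t = proj₁ T-min i i<lo in t , T⊆T⁺ t∈T , i~t
  ... | no i≮lo = b , b∈T⁺ , meets i (≮⇒≥ i≮lo) (<-≤-trans i<j j≤hi)

  -- A smaller transversal S either omits some u ∈ T, and then S - b is a transversal of level lo
  -- (b avoids those edges) inside T - u, or omits b, and then S ⊆ T misses the missed edge.
  T⁺-minimal : ∀ {j} → lo ≤ j → j ≤ hi → Missed j → MinTr G j T⁺
  T⁺-minimal {j} lo≤j j≤hi (e , e<j , uncovered) = T⁺-transversal j≤hi , minimal
    where
    minimal : ∀ S → S ⊂ T⁺ → ¬ IsTransversal G j S
    minimal S (S⊆T⁺ , u , u∈T⁺ , u∉S) S-tr with x∈p∪⁅y⁆⁻ T u∈T⁺
    ... | inj₂ refl =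
      let s , s∈S , e~s = S-tr e e<j in
      uncovered (s , p⊆q∪⁅x⁆⇒p-x⊆q S⊆T⁺ (x∈p∧x≢y⇒x∈p-y s∈S λ { refl → u∉S s∈S }) , e~s)
    ... | inj₁ u∈T = proj₂ T-min (S - b) (p⊆q∪⁅x⁆⇒p-x⊆q S⊆T⁺ , u , u∈T , λ u∈S-b → u∉S (p─q⊆p S ⁅ b ⁆ u∈S-b))
                       S-b-transversal
      where
      S-b-transversal : IsTransversal G lo (S - b)
      S-b-transversal i i<lo =
        let s , s∈S , i~s = S-tr i (<-≤-trans i<lo lo≤j) in
        s , x∈p∧x≢y⇒x∈p-y s∈S (λ { refl → avoids i i<lo i~s }) , i~s

  T⁺-b≡T : b ∉ T → T⁺ - b ≡ T
  T⁺-b≡T b∉T = ⊆-antisym (p⊆q∪⁅x⁆⇒p-x⊆q (λ t∈ → t∈)) λ t∈T → x∈p∧x≢y⇒x∈p-y (T⊆T⁺ t∈T) λ { refl → b∉T t∈T }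

  b-private : ∀ {ι} → lo ≤ toℕ ι → toℕ ι < hi → IsTransversal G (toℕ ι) T → ¬ Covers G T ι →
              PrivateOnly G ι b T⁺
  b-private {ι} lo≤ι ι<hi tr uncovered = (b∈T⁺ , meets ι lo≤ι ι<hi , only-b) , only-ι
    where
    only-b : ∀ t → t ∈ T⁺ → InN G ι t → t ≡ b
    only-b t t∈T⁺ ι~t with x∈p∪⁅y⁆⁻ T t∈T⁺
    ... | inj₁ t∈T = ⊥-elim (uncovered (t , t∈T , ι~t))
    ... | inj₂ t≡b = t≡b
    only-ι : ∀ i → toℕ i ≤ toℕ ι → Hits G i T⁺ b → SameN G i ι
    only-ι i i≤ι (_ , _ , hit-only-by-b) with m≤n⇒m<n∨m≡n i≤ι
    ... | inj₂ i≡ι rewrite toℕ-injective i≡ι = λ _ → ⇔-id _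
    ... | inj₁ i<ι =
      let t , t∈T , i~t = tr i i<ι in
      ⊥-elim (b∉T lo≤ι ι<hi uncovered (subst (_∈ T) (hit-only-by-b t (T⊆T⁺ t∈T) i~t) t∈T))

  data Stage (j : ℕ) : Subset (m G) → Set where
    unchanged : IsTransversal G j T → Stage j T
    extended  : Missed j → Stage j T⁺

  Stage-minTr : ∀ {j S} → lo ≤ j → j ≤ hi → Stage j S → MinTr G j S
  Stage-minTr lo≤j _ (unchanged tr) = MinTr-raise T-min lo≤j tr
  Stage-minTr lo≤j j≤hi (extended missed) = T⁺-minimal lo≤j j≤hi missed

  Stage-step : ∀ ι {S} → lo ≤ toℕ ι → toℕ ι < hi → Stage (toℕ ι) S →
               Σ (Subset (m G)) λ S' → ParentAt G ι S' S × Stage (suc (toℕ ι)) S'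
  Stage-step ι lo≤ι ι<hi (extended missed) =
    T⁺ , ParentAt-self (Stage-minTr lo≤ι (<⇒≤ ι<hi) (extended missed))
                       (Stage-minTr (≤-trans lo≤ι (n≤1+n _)) ι<hi (extended (Missed-suc missed)))
       , extended (Missed-suc missed)
  Stage-step ι lo≤ι ι<hi (unchanged tr) with covers? G T ι
  ... | yes covered =
    T , ParentAt-self (MinTr-raise T-min lo≤ι tr) (MinTr-raise T-min (≤-trans lo≤ι (n≤1+n _)) tr′)
      , unchanged tr′
    where
    tr′ : IsTransversal G (suc (toℕ ι)) T
    tr′ = IsTransversal-suc tr covered
  ... | no uncovered =
    T⁺ , (Stage-minTr (≤-trans lo≤ι (n≤1+n _)) ι<hi (extended ι-missed) ,
          inj₂ (T⁺-not-minimal , b , b∈T⁺ , b-private lo≤ι ι<hi tr uncovered , sym (T⁺-b≡T b∉T′)))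
       , extended ι-missed
    where
    ι-missed : Missed (suc (toℕ ι))
    ι-missed = ι , ≤-refl , uncovered
    b∉T′ : b ∉ T
    b∉T′ = b∉T lo≤ι ι<hi uncovered
    T⁺-not-minimal : ¬ MinTr G (toℕ ι) T⁺
    T⁺-not-minimal (_ , minimal) = minimal T (T⊆T⁺ , b , b∈T⁺ , b∉T′) tr

  descendant : lo ≤ hi → hi ≤ m G → Σ (Subset (m G)) λ T' → MinTr G hi T' × Descends G lo (hi ∸ lo) T' T
  descendant lo≤hi hi≤m =
    let T' , T'-descends , stage = descend G Stage lo≤hi hi≤m Stage-step (unchanged (proj₁ T-min)) in
    T' , Stage-minTr lo≤hi ≤-refl stage , T'-descends

module Levels (G : Graph) (k : ℕ) (b : Fin k → Fin (m G)) where

  EndsInV : ℕ → Fin (m G) → Set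
  EndsInV j e = InV G k b j (proj₁ (ends G e)) × InV G k b j (proj₂ (ends G e))

  ∈Ej⇔ : ∀ {j e} → e ∈ Ej G k b j ⇔ EndsInV j e
  ∈Ej⇔ {j} {e} = T-does-∧⇔ (inV? G k b j (proj₁ (ends G e))) (inV? G k b j (proj₂ (ends G e)))
                 ⇔-∘ ∈tabulate⇔ (λ e → does (inV? G k b j (proj₁ (ends G e))) ∧ does (inV? G k b j (proj₂ (ends G e))))

  ∈Ej⁻ : ∀ {j e} → e ∈ Ej G k b j → EndsInV j e
  ∈Ej⁻ = Equivalence.to ∈Ej⇔

  ∈Ej⁺ : ∀ {j e} → EndsInV j e → e ∈ Ej G k b j
  ∈Ej⁺ = Equivalence.from ∈Ej⇔

  InV-mono : ∀ {a c v} → a ≤ c → InV G k b a v → InV G k b c v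
  InV-mono a≤c v∈ j c<j+1 = v∈ j (≤-<-trans a≤c c<j+1)

  InV-top : ∀ v → InV G k b k v
  InV-top v j k<j+1 = ⊥-elim (<⇒≱ (toℕ<n j) (s≤s⁻¹ k<j+1))

  InV-suc⁻ : ∀ {j v} ι → toℕ ι ≡ j → InV G k b (suc j) v → ¬ Incident G v (b ι) → InV G k b j v
  InV-suc⁻ ι refl v∈ v≁bι j ι<j+1 with toℕ j ℕ.≟ toℕ ι
  ... | yes j≡ι rewrite toℕ-injective j≡ι = v≁bι
  ... | no j≢ι = v∈ j (s≤s (≤∧≢⇒< (s≤s⁻¹ ι<j+1) λ ι≡j → j≢ι (sym ι≡j)))

  Ej-mono : ∀ {a c} → a ≤ c → Ej G k b a ⊆ Ej G k b c
  Ej-mono a≤c e∈ = let x∈ , y∈ = ∈Ej⁻ e∈ in ∈Ej⁺ (InV-mono a≤c x∈ , InV-mono a≤c y∈)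

  ∈Ej-top : ∀ e → e ∈ Ej G k b k
  ∈Ej-top e = ∈Ej⁺ (InV-top _ , InV-top _)

  endpoint-∈V : ∀ {j e v} → e ∈ Ej G k b j → Incident G v e → InV G k b j v
  endpoint-∈V e∈ (inj₁ refl) = proj₁ (∈Ej⁻ e∈)
  endpoint-∈V e∈ (inj₂ refl) = proj₂ (∈Ej⁻ e∈)

  enters-at : ∀ {a f} c → a ≤ c → f ∉ Ej G k b a → f ∈ Ej G k b c →
              Σ ℕ λ j → a ≤ j × j < c × f ∈ Ej G k b (suc j) × f ∉ Ej G k b j
  enters-at zero z≤n f∉ f∈ = ⊥-elim (f∉ f∈)
  enters-at {f = f} (suc c) a≤c+1 f∉ f∈ with m≤n⇒m<n∨m≡n a≤c+1
  ... | inj₂ refl = ⊥-elim (f∉ f∈)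
  ... | inj₁ a≤c with f ∈? Ej G k b c
  ...   | no f∉c = c , s≤s⁻¹ a≤c , ≤-refl , f∈ , f∉c
  ...   | yes f∈c = let j , a≤j , j<c , entry = enters-at c (s≤s⁻¹ a≤c) f∉ f∈c in
                    j , a≤j , m≤n⇒m≤1+n j<c , entry

  Ej-initial : OrderCond1 G k b → ∀ {a} → a ≤ k → IsInitial (Ej G k b a)
  Ej-initial order {a} a≤k e f e∈ f∉ with enters-at k a≤k f∉ (∈Ej-top f)
  ... | j , a≤j , j<k , f∈j+1 , f∉j = ordered (fromℕ< j<k) (toℕ-fromℕ< j<k) a≤j f∈j+1 f∉j
    where
    ordered : ∀ {l} (ι : Fin k) → toℕ ι ≡ l → a ≤ l → f ∈ Ej G k b (suc l) → f ∉ Ej G k b l → toℕ e < toℕ f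
    ordered ι refl a≤ι f∈ f∉ = order ι e f (Ej-mono a≤ι e∈) (f∈ , f∉)

  Ej-avoids : ∀ {j e} ι → e ∈ Ej G k b j → j ≤ toℕ ι → ¬ InN G e (b ι)
  Ej-avoids ι e∈ j≤ι (v , v~e , v~bι) = endpoint-∈V e∈ v~e ι (s≤s j≤ι) v~bι

  Ej-new-meets : ∀ {j e} ι → toℕ ι ≡ j → e ∈ Ej G k b (suc j) → e ∉ Ej G k b j → InN G e (b ι)
  Ej-new-meets {e = e} ι ι≡j e∈ e∉
    with incident? G (proj₁ (ends G e)) (b ι) | incident? G (proj₂ (ends G e)) (b ι)
  ... | yes x~bι | _ = _ , inj₁ refl , x~bι
  ... | no _ | yes y~bι = _ , inj₂ refl , y~bι
  ... | no x≁bι | no y≁bι =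
    let x∈ , y∈ = ∈Ej⁻ e∈ in
    ⊥-elim (e∉ (∈Ej⁺ (InV-suc⁻ ι ι≡j x∈ x≁bι , InV-suc⁻ ι ι≡j y∈ y≁bι)))

lemma4 : (G : Graph) (k : ℕ) (b : Fin k → Fin (m G)) (x y : Fin k → Fin (n G)) →
         IsMaximalMatching G k b →
         (∀ j → ends G (b j) ≡ (x j , y j) ⊎ ends G (b j) ≡ (y j , x j)) →
         OrderCond1 G k b →
         OrderCond2 G k b x y →
         (i : ℕ) → 1 ≤ i → i < k →
         (T : Subset (m G)) → MinTr G (∣ Ej G k b (i ∸ 1) ∣) T →
         Σ (Subset (m G)) λ T' → MinTr G (∣ Ej G k b i ∣) T' ×
           Descends G (∣ Ej G k b (i ∸ 1) ∣) (∣ Ej G k b i ∣ ∸ ∣ Ej G k b (i ∸ 1) ∣) T' T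
lemma4 G k b _ _ _ _ order₁ _ (suc i) _ i+1<k T T-min =
  descendant (p⊆q⇒∣p∣≤∣q∣ {p = Ej G k b i} (Ej-mono (n≤1+n i))) (∣p∣≤n (Ej G k b (suc i)))
  where
  open Levels G k b
  open Equivalence

  i<k : i < k
  i<k = ≤-trans (n≤1+n _) i+1<k

  ι : Fin k
  ι = fromℕ< i<k

  Ei-initial : ∀ e → e ∈ Ej G k b i ⇔ toℕ e < ∣ Ej G k b i ∣
  Ei-initial = initial-∈⇔<∣∣ (Ej-initial order₁ (<⇒≤ i<k))

  Ei+1-initial : ∀ e → e ∈ Ej G k b (suc i) ⇔ toℕ e < ∣ Ej G k b (suc i) ∣
  Ei+1-initial = initial-∈⇔<∣∣ (Ej-initial order₁ (<⇒≤ i+1<k))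

  avoids : ∀ e → toℕ e < ∣ Ej G k b i ∣ → ¬ InN G e (b ι)
  avoids e e<lo = Ej-avoids ι (from (Ei-initial e) e<lo) (≤-reflexive (sym (toℕ-fromℕ< i<k)))

  meets : ∀ e → ∣ Ej G k b i ∣ ≤ toℕ e → toℕ e < ∣ Ej G k b (suc i) ∣ → InN G e (b ι)
  meets e lo≤e e<hi =
    Ej-new-meets ι (toℕ-fromℕ< i<k) (from (Ei+1-initial e) e<hi) λ e∈ → <⇒≱ (to (Ei-initial e) e∈) lo≤e

  open Extension G (b ι) avoids meets T T-min
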